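{- For every $n\ge 4$, the cycle $C_n$ on $n$ vertices satisfies $rc^\ell(C_n)=src^\ell(C_n)=\lceil n/2\rceil$.
   Context: An edge-coloured path is rainbow if all its edges have distinct colours; a geodesic is a shortest path between its endpoints. An (not necessarily proper) edge-colouring of a connected graph is rainbow connected (resp. strongly rainbow connected) if any two vertices are joined by a rainbow path (resp. rainbow geodesic). An $r$-edge-list assignment of $G$ assigns to each edge $e$ a set $L(e)\subset\mathbb N$ with $|L(e)|\ge r$; an $L$-edge-colouring is an edge-colouring $c$ with $c(e)\in L(e)$ for all $e$. $rc^\ell(G)$ (resp. $src^\ell(G)$) is the minimum integer $r$ such that for every $r$-edge-list assignment $L$ of $G$ there exists a rainbow connected (resp. strongly rainbow connected) $L$-edge-colouring of $G$. -}

module Defs where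

open import Data.Nat using (ℕ; suc; _≤_; _<_)
open import Data.Nat.DivMod using (_%_; m%n<n)
open import Data.Fin using (Fin; toℕ; fromℕ<)
open import Data.Product using (Σ; _×_; _,_; ∃)
open import Data.Sum using (_⊎_)
open import Data.List using (List; []; _∷_; map; length)
open import Data.List.Membership.Propositional using (_∈_)
open import Data.List.Relation.Unary.Unique.Propositional using (Unique)
open import Relation.Binary.PropositionalEquality using (_≡_)

record Graph : Set where
  field
    V    : ℕ
    E    : ℕ
    ends : Fin E → Fin V × Fin V
open Graph public

module _ (G : Graph) where

  Joins : Fin (E G) → Fin (V G) → Fin (V G) → Set
  Joins e u v = (ends G e ≡ (u , v)) ⊎ (ends G e ≡ (v , u))

  data Walk : Fin (V G) → Fin (V G) → Set where
    []   : ∀ {u} → Walk u u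
    step : ∀ {u v w} (e : Fin (E G)) → Joins e u v → Walk v w → Walk u w

  walkEdges : ∀ {u w} → Walk u w → List (Fin (E G))
  walkEdges []           = []
  walkEdges (step e _ p) = e ∷ walkEdges p

  walkVertices : ∀ {u w} → Walk u w → List (Fin (V G))
  walkVertices {u} []           = u ∷ []
  walkVertices {u} (step _ _ p) = u ∷ walkVertices p

  walkLength : ∀ {u w} → Walk u w → ℕ
  walkLength p = length (walkEdges p)

  IsPath : ∀ {u w} → Walk u w → Set
  IsPath p = Unique (walkVertices p)

  IsGeodesic : ∀ {u w} → Walk u w → Set
  IsGeodesic {u} {w} p =
    IsPath p × (∀ (q : Walk u w) → IsPath q → walkLength p ≤ walkLength q)

  EdgeColouring : Set
  EdgeColouring = Fin (E G) → ℕ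

  IsRainbow : ∀ {u w} → EdgeColouring → Walk u w → Set
  IsRainbow c p = Unique (map c (walkEdges p))

  RainbowConnected : EdgeColouring → Set
  RainbowConnected c =
    ∀ (u w : Fin (V G)) → Σ (Walk u w) λ p → IsPath p × IsRainbow c p

  StronglyRainbowConnected : EdgeColouring → Set
  StronglyRainbowConnected c =
    ∀ (u w : Fin (V G)) → Σ (Walk u w) λ p → IsGeodesic p × IsRainbow c p

  record ListAssignment (r : ℕ) : Set where
    field
      lists    : Fin (E G) → List ℕ
      distinct : ∀ e → Unique (lists e)
      large    : ∀ e → r ≤ length (lists e)
  open ListAssignment public

  IsLColouring : ∀ {r} → ListAssignment r → EdgeColouring → Set
  IsLColouring L c = ∀ e → c e ∈ lists L e

  ListChoosable : (EdgeColouring → Set) → ℕ → Set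
  ListChoosable P r =
    ∀ (L : ListAssignment r) → Σ EdgeColouring λ c → IsLColouring L c × P c

  IsMinListNumber : (EdgeColouring → Set) → ℕ → Set
  IsMinListNumber P k = ListChoosable P k × (∀ r → ListChoosable P r → k ≤ r)

  ListRainbowConnectionNumber : ℕ → Set
  ListRainbowConnectionNumber = IsMinListNumber RainbowConnected

  ListStrongRainbowConnectionNumber : ℕ → Set
  ListStrongRainbowConnectionNumber = IsMinListNumber StronglyRainbowConnected

next : ∀ {n} → Fin n → Fin n
next {suc m} i = fromℕ< (m%n<n (suc (toℕ i)) (suc m))

Cycle : ℕ → Graph
Cycle n = record { V = n ; E = n ; ends = λ i → (i , next i) }

-- Upper bound: pair every edge i of the cycle with the edge i + ⌊n/2⌋; ⌈n/2⌉ such pairs cover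
-- all edges. From lists of ⌈n/2⌉ colours one can choose colours so that edges of different pairs
-- get different colours: a colour common to both lists of a pair is used for the whole pair and
-- deleted from all other lists, and once no pair has a common colour Hall's theorem applies to
-- the 2k lists of the k remaining pairs. Then every arc with at most ⌊n/2⌋ edges is rainbow, and
-- the shorter of the two arcs between two vertices is a geodesic.
--
-- Lower bound: with all lists equal to {0, …, r - 1}, a rainbow path between opposite vertices has
-- at least ⌊n/2⌋ edges, so r ≥ ⌊n/2⌋. For odd n and r = ⌊n/2⌋, an arc with ⌊n/2⌋ edges is the
-- only path that short between its ends, so every such arc is rainbow; this makes the colouring
-- ⌊n/2⌋-periodic, hence (as n = 2⌊n/2⌋ + 1) constant, which is absurd.

module Submission where

open import Defs

open import Data.Bool using (Bool; true; false)
open import Data.Fin using (Fin; zero; suc; toℕ; fromℕ<; _↑ˡ_; _↑ʳ_; splitAt; punchIn; punchOut)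
open import Data.Fin.Properties
  using (_≟_; any?; toℕ-injective; toℕ<n; toℕ-fromℕ<; splitAt-↑ˡ; splitAt-↑ʳ; punchIn-punchOut)
open import Data.Fin.Subset
open import Data.Fin.Subset.Properties
open import Data.List using (List; []; _∷_; _∷ʳ_; length; applyUpTo)
import Data.List as List
open import Data.List.Extrema.Nat using (max; xs≤max)
open import Data.List.Membership.Propositional using () renaming (_∈_ to _∈ₗ_)
open import Data.List.Membership.Propositional.Properties
  using (∈-applyUpTo⁺; ∈-applyUpTo⁻; ∈-map⁺; ∈-map⁻; ∈-upTo⁻; ∈-concat⁺′; ∈-allFin)
open import Data.List.Properties
  using (unfold-reverse; reverse-map; length-reverse; length-map; length-applyUpTo; length-upTo)
open import Data.List.Relation.Binary.Permutation.Propositional using (↭-sym; ↭⇒↭ₛ)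
open import Data.List.Relation.Binary.Permutation.Propositional.Properties using (↭-reverse)
import Data.List.Relation.Binary.Permutation.Setoid.Properties as Permutationₛ
import Data.List.Relation.Unary.All as All
open import Data.List.Relation.Unary.AllPairs using ([]; _∷_)
open import Data.List.Relation.Unary.Any using (here; there)
open import Data.List.Relation.Unary.Unique.Propositional using (Unique)
open import Data.List.Relation.Unary.Unique.Propositional.Properties using (applyUpTo⁺₁; upTo⁺)
open import Data.Nat
  using (ℕ; zero; suc; _+_; _∸_; _⊓_; _≤_; _<_; _≤?_; _<?_; z≤n; s≤s; s≤s⁻¹; z<s; ⌊_/2⌋; ⌈_/2⌉;
         NonZero; >-nonZero; >-nonZero⁻¹)
open import Data.Nat.DivMod using (_%_; m%n<n; %-distribˡ-+; m%n%n≡m%n; m<n⇒m%n≡m; [m+n]%n≡m%n)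
open import Data.Nat.Induction using (<-wellFounded)
open import Data.Nat.Properties hiding (_≟_)
open import Data.List.Membership.DecPropositional Data.Nat.Properties._≟_
  using () renaming (_∈?_ to _∈ₗ?_)
open import Algebra.Properties.CommutativeSemigroup +-commutativeSemigroup using (x∙yz≈y∙xz)
open import Data.Product using (Σ; ∃; ∃₂; _×_; _,_; proj₁; proj₂; uncurry)
open import Data.Sum using (_⊎_; inj₁; inj₂; [_,_]′; swap)
import Data.Sum as Sum
open import Data.Vec using ([]; _∷_; _++_; tabulate)
import Data.Vec as Vec
open import Data.Vec.Properties using (lookup∘tabulate; []=⇒lookup; lookup⇒[]=)
open import Data.Vec.Functional using (updateAt; insertAt)
open import Data.Vec.Functional.Properties
  using (updateAt-updates; updateAt-minimal; insertAt-lookup; insertAt-punchIn)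
open import Function using (_∘_)
open import Function.Definitions using (Injective)
open import Induction.WellFounded using (Acc; acc)
open import Relation.Binary.PropositionalEquality
open import Relation.Binary.PropositionalEquality.Properties using (setoid)
open import Relation.Nullary using (¬_; yes; no; does; contradiction)
open import Relation.Nullary.Decidable using (_×-dec_)

private variable m n : ℕ

∣p∪q∣+∣p∩q∣≡∣p∣+∣q∣ : ∀ (p q : Subset n) → ∣ p ∪ q ∣ + ∣ p ∩ q ∣ ≡ ∣ p ∣ + ∣ q ∣
∣p∪q∣+∣p∩q∣≡∣p∣+∣q∣ []            []            = refl
∣p∪q∣+∣p∩q∣≡∣p∣+∣q∣ (outside ∷ p) (outside ∷ q) = ∣p∪q∣+∣p∩q∣≡∣p∣+∣q∣ p q
∣p∪q∣+∣p∩q∣≡∣p∣+∣q∣ (inside  ∷ p) (outside ∷ q) = cong suc (∣p∪q∣+∣p∩q∣≡∣p∣+∣q∣ p q)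
∣p∪q∣+∣p∩q∣≡∣p∣+∣q∣ (outside ∷ p) (inside  ∷ q) =
  trans (cong suc (∣p∪q∣+∣p∩q∣≡∣p∣+∣q∣ p q)) (sym (+-suc ∣ p ∣ ∣ q ∣))
∣p∪q∣+∣p∩q∣≡∣p∣+∣q∣ (inside  ∷ p) (inside  ∷ q) = cong suc (begin
  ∣ p ∪ q ∣ + suc ∣ p ∩ q ∣ ≡⟨ +-suc ∣ p ∪ q ∣ ∣ p ∩ q ∣ ⟩
  suc (∣ p ∪ q ∣ + ∣ p ∩ q ∣) ≡⟨ cong suc (∣p∪q∣+∣p∩q∣≡∣p∣+∣q∣ p q) ⟩
  suc (∣ p ∣ + ∣ q ∣)         ≡⟨ +-suc ∣ p ∣ ∣ q ∣ ⟨
  ∣ p ∣ + suc ∣ q ∣           ∎)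
  where open ≡-Reasoning

Empty⇒∣p∣≡0 : ∀ {p : Subset n} → Empty p → ∣ p ∣ ≡ 0
Empty⇒∣p∣≡0 {n} empty = trans (cong ∣_∣ (Empty-unique empty)) (∣⊥∣≡0 n)

disjoint⇒∣p∪q∣≡∣p∣+∣q∣ : ∀ {p q : Subset n} → Empty (p ∩ q) → ∣ p ∪ q ∣ ≡ ∣ p ∣ + ∣ q ∣
disjoint⇒∣p∪q∣≡∣p∣+∣q∣ {p = p} {q} disjoint = begin
  ∣ p ∪ q ∣                 ≡⟨ +-identityʳ ∣ p ∪ q ∣ ⟨
  ∣ p ∪ q ∣ + 0             ≡⟨ cong (∣ p ∪ q ∣ +_) (Empty⇒∣p∣≡0 disjoint) ⟨
  ∣ p ∪ q ∣ + ∣ p ∩ q ∣     ≡⟨ ∣p∪q∣+∣p∩q∣≡∣p∣+∣q∣ p q ⟩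
  ∣ p ∣ + ∣ q ∣             ∎
  where open ≡-Reasoning

∣p∪q∣≤∣p∣+∣q∣ : ∀ (p q : Subset n) → ∣ p ∪ q ∣ ≤ ∣ p ∣ + ∣ q ∣
∣p∪q∣≤∣p∣+∣q∣ p q = ≤-trans (m≤m+n ∣ p ∪ q ∣ ∣ p ∩ q ∣) (≤-reflexive (∣p∪q∣+∣p∩q∣≡∣p∣+∣q∣ p q))

∣p∣≤1+∣p-x∣ : ∀ (p : Subset n) x → ∣ p ∣ ≤ suc ∣ p - x ∣
∣p∣≤1+∣p-x∣ p x = begin
  ∣ p ∣                 ≤⟨ p⊆q⇒∣p∣≤∣q∣ p⊆⁅x⁆∪[p-x] ⟩
  ∣ ⁅ x ⁆ ∪ (p - x) ∣   ≤⟨ ∣p∪q∣≤∣p∣+∣q∣ ⁅ x ⁆ (p - x) ⟩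
  ∣ ⁅ x ⁆ ∣ + ∣ p - x ∣ ≡⟨ cong (_+ ∣ p - x ∣) (∣⁅x⁆∣≡1 x) ⟩
  suc ∣ p - x ∣         ∎
  where
  open ≤-Reasoning
  p⊆⁅x⁆∪[p-x] : p ⊆ ⁅ x ⁆ ∪ (p - x)
  p⊆⁅x⁆∪[p-x] {y} y∈p with y ≟ x
  ... | yes refl = x∈p∪q⁺ (inj₁ (x∈⁅x⁆ y))
  ... | no y≢x   = x∈p∪q⁺ (inj₂ (x∈p∧x≢y⇒x∈p-y y∈p y≢x))

x∈p─q⇒x∉q : ∀ {x : Fin n} (p q : Subset n) → x ∈ p ─ q → x ∉ q
x∈p─q⇒x∉q {x = zero}  (s ∷ p) (outside ∷ q) _              ()
x∈p─q⇒x∉q {x = suc x} (s ∷ p) (t ∷ q)       (Vec.there x∈) (Vec.there x∈q) =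
  x∈p─q⇒x∉q p q x∈ x∈q

x∈p-y⇒x≢y : ∀ {x y : Fin n} {p} → x ∈ p - y → x ≢ y
x∈p-y⇒x≢y {x = x} {p = p} x∈ refl = x∈p─q⇒x∉q p ⁅ x ⁆ x∈ (x∈⁅x⁆ x)

∣p∣>0⇒Nonempty : ∀ (p : Subset n) → 0 < ∣ p ∣ → Nonempty p
∣p∣>0⇒Nonempty (inside  ∷ p) _     = zero , Vec.here
∣p∣>0⇒Nonempty (outside ∷ p) 0<∣p∣ =
  let x , x∈p = ∣p∣>0⇒Nonempty p 0<∣p∣ in suc x , Vec.there x∈p

x∈p⇒∣p∣>0 : ∀ {x} {p : Subset n} → x ∈ p → 0 < ∣ p ∣
x∈p⇒∣p∣>0 x∈p = <-≤-trans z<s (x∈p⇒∣p-x∣<∣p∣ x∈p)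

twoElements⇒∣p∣>1 : ∀ {x y} {p : Subset n} → x ∈ p → y ∈ p → x ≢ y → 1 < ∣ p ∣
twoElements⇒∣p∣>1 x∈p y∈p x≢y =
  ≤-trans (s≤s (x∈p⇒∣p∣>0 (x∈p∧x≢y⇒x∈p-y y∈p (x≢y ∘ sym)))) (x∈p⇒∣p-x∣<∣p∣ x∈p)

∣p∣>1⇒twoElements : ∀ (p : Subset n) → 1 < ∣ p ∣ → ∃₂ λ x y → x ∈ p × y ∈ p × x ≢ y
∣p∣>1⇒twoElements p 1<∣p∣ =
  let x , x∈p   = ∣p∣>0⇒Nonempty p (<-trans z<s 1<∣p∣)
      y , y∈p-x = ∣p∣>0⇒Nonempty (p - x) (s≤s⁻¹ (≤-trans 1<∣p∣ (∣p∣≤1+∣p-x∣ p x)))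
  in x , y , x∈p , p─q⊆p p ⁅ x ⁆ y∈p-x , λ x≡y → x∈p-y⇒x≢y y∈p-x (sym x≡y)

∣p++q∣≡∣p∣+∣q∣ : ∀ (p : Subset m) (q : Subset n) → ∣ p ++ q ∣ ≡ ∣ p ∣ + ∣ q ∣
∣p++q∣≡∣p∣+∣q∣ []            q = refl
∣p++q∣≡∣p∣+∣q∣ (inside  ∷ p) q = cong suc (∣p++q∣≡∣p∣+∣q∣ p q)
∣p++q∣≡∣p∣+∣q∣ (outside ∷ p) q = ∣p++q∣≡∣p∣+∣q∣ p q

∈-++⁺ˡ : ∀ {x : Fin m} {p : Subset m} (q : Subset n) → x ∈ p → x ↑ˡ n ∈ p ++ q
∈-++⁺ˡ q Vec.here        = Vec.here
∈-++⁺ˡ q (Vec.there x∈p) = Vec.there (∈-++⁺ˡ q x∈p)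

∈-++⁺ʳ : ∀ {x : Fin n} (p : Subset m) {q : Subset n} → x ∈ q → m ↑ʳ x ∈ p ++ q
∈-++⁺ʳ []      x∈q = x∈q
∈-++⁺ʳ (s ∷ p) x∈q = Vec.there (∈-++⁺ʳ p x∈q)

∈-tabulate⁺ : ∀ {f : Fin n → Bool} {z} → f z ≡ true → z ∈ tabulate f
∈-tabulate⁺ {f = f} {z} fz = lookup⇒[]= z (tabulate f) (trans (lookup∘tabulate f z) fz)

∈-tabulate⁻ : ∀ {f : Fin n → Bool} {z} → z ∈ tabulate f → f z ≡ true
∈-tabulate⁻ {f = f} {z} z∈ = trans (sym (lookup∘tabulate f z)) ([]=⇒lookup z∈)

-- Hall's theorem

⋃[_]_ : Subset n → (Fin n → Subset m) → Subset m
⋃[ []          ] A = ⊥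
⋃[ inside  ∷ S ] A = A zero ∪ ⋃[ S ] (A ∘ suc)
⋃[ outside ∷ S ] A = ⋃[ S ] (A ∘ suc)

∈⋃⁺ : ∀ (S : Subset n) (A : Fin n → Subset m) {v x} → v ∈ S → x ∈ A v → x ∈ ⋃[ S ] A
∈⋃⁺ (inside  ∷ S) A Vec.here        x∈Av = x∈p∪q⁺ (inj₁ x∈Av)
∈⋃⁺ (inside  ∷ S) A (Vec.there v∈S) x∈Av = x∈p∪q⁺ (inj₂ (∈⋃⁺ S (A ∘ suc) v∈S x∈Av))
∈⋃⁺ (outside ∷ S) A (Vec.there v∈S) x∈Av = ∈⋃⁺ S (A ∘ suc) v∈S x∈Av

∈⋃⁻ : ∀ (S : Subset n) (A : Fin n → Subset m) {x} → x ∈ ⋃[ S ] A → ∃ λ v → v ∈ S × x ∈ A v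
∈⋃⁻ []            A x∈⋃ = contradiction x∈⋃ ∉⊥
∈⋃⁻ (inside  ∷ S) A x∈⋃ with x∈p∪q⁻ (A zero) (⋃[ S ] (A ∘ suc)) x∈⋃
... | inj₁ x∈A0 = zero , Vec.here , x∈A0
... | inj₂ x∈⋃S = let v , v∈S , x∈Av = ∈⋃⁻ S (A ∘ suc) x∈⋃S in suc v , Vec.there v∈S , x∈Av
∈⋃⁻ (outside ∷ S) A x∈⋃ = let v , v∈S , x∈Av = ∈⋃⁻ S (A ∘ suc) x∈⋃ in suc v , Vec.there v∈S , x∈Av

⋃-⊆ : ∀ (S : Subset n) (A : Fin n → Subset m) {p} → (∀ {v} → v ∈ S → A v ⊆ p) → ⋃[ S ] A ⊆ p
⋃-⊆ S A Av⊆p x∈⋃ = let v , v∈S , x∈Av = ∈⋃⁻ S A x∈⋃ in Av⊆p v∈S x∈Av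

HallCondition : (Fin n → Subset m) → Set
HallCondition A = ∀ S → ∣ S ∣ ≤ ∣ ⋃[ S ] A ∣

DistinctRepresentatives : (Fin n → Subset m) → Set
DistinctRepresentatives {n} {m} A =
  Σ (Fin n → Fin m) λ c → (∀ v → c v ∈ A v) × Injective _≡_ _≡_ c

hallCondition? : ∀ (A : Fin n → Subset m) → HallCondition A ⊎ ∃ λ S → ∣ ⋃[ S ] A ∣ < ∣ S ∣
hallCondition? A with anySubset? (λ S → ∣ ⋃[ S ] A ∣ <? ∣ S ∣)
... | yes violator = inj₂ violator
... | no ¬violator = inj₁ λ S → ≮⇒≥ (¬violator ∘ (S ,_))

removeFrom : (Fin n → Subset m) → Fin n → Fin m → Fin n → Subset m
removeFrom A v x = updateAt A v (_- x)

removeFrom-⊆ : ∀ (A : Fin n → Subset m) v x w → removeFrom A v x w ⊆ A w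
removeFrom-⊆ A v x w with w ≟ v
... | yes refl = subst (_⊆ A w) (sym (updateAt-updates w A)) (p─q⊆p (A w) ⁅ x ⁆)
... | no w≢v   = ⊆-reflexive (updateAt-minimal w v A w≢v)

∈-removeFrom : ∀ (A : Fin n → Subset m) v x {w z} → z ∈ A w → (w ≡ v → z ≢ x) →
               z ∈ removeFrom A v x w
∈-removeFrom A v x {w} z∈Aw z≢x with w ≟ v
... | yes refl = subst (_ ∈_) (sym (updateAt-updates w A)) (x∈p∧x≢y⇒x∈p-y z∈Aw (z≢x refl))
... | no w≢v   = subst (_ ∈_) (sym (updateAt-minimal w v A w≢v)) z∈Aw

module _ {A : Fin n → Subset m} (hallA : HallCondition A) (v : Fin n) where

  private
    Violates : Fin m → Subset n → Set
    Violates x S = ∣ ⋃[ S ] removeFrom A v x ∣ < ∣ S ∣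

  violator-∋ : ∀ {x} S → Violates x S → v ∈ S
  violator-∋ {x} S violS with v ∈? S
  ... | yes v∈S = v∈S
  ... | no  v∉S = contradiction (≤-trans (hallA S) (p⊆q⇒∣p∣≤∣q∣ ⋃A⊆⋃A-x)) (<⇒≱ violS)
    where
    ⋃A⊆⋃A-x : ⋃[ S ] A ⊆ ⋃[ S ] removeFrom A v x
    ⋃A⊆⋃A-x = ⋃-⊆ S A λ w∈S z∈Aw →
      ∈⋃⁺ S _ w∈S (∈-removeFrom A v x z∈Aw λ { refl → contradiction w∈S v∉S })

  violators-incompatible : ∀ {x y} → x ≢ y → ∀ S T → Violates x S → ¬ Violates y T
  violators-incompatible {x} {y} x≢y S T violS violT =
    <-irrefl refl (<-≤-trans (+-mono-≤-< violS violT) bound)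
    where
    X = ⋃[ S ] removeFrom A v x
    Y = ⋃[ T ] removeFrom A v y

    cover : ∀ {w} → w ∈ S ∪ T → A w ⊆ X ∪ Y
    cover {w} w∈S∪T {z} z∈Aw with w ≟ v | z ≟ x | x∈p∪q⁻ S T w∈S∪T
    ... | yes refl | yes refl | _ =
      x∈p∪q⁺ (inj₂ (∈⋃⁺ T _ (violator-∋ T violT) (∈-removeFrom A v y z∈Aw λ _ → x≢y)))
    ... | yes refl | no z≢x   | _ =
      x∈p∪q⁺ (inj₁ (∈⋃⁺ S _ (violator-∋ S violS) (∈-removeFrom A v x z∈Aw λ _ → z≢x)))
    ... | no w≢v   | _        | inj₁ w∈S =
      x∈p∪q⁺ (inj₁ (∈⋃⁺ S _ w∈S (∈-removeFrom A v x z∈Aw (λ w≡v → contradiction w≡v w≢v))))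
    ... | no w≢v   | _        | inj₂ w∈T =
      x∈p∪q⁺ (inj₂ (∈⋃⁺ T _ w∈T (∈-removeFrom A v y z∈Aw (λ w≡v → contradiction w≡v w≢v))))

    common : ∀ {w} → w ∈ S ∩ T - v → A w ⊆ X ∩ Y
    common w∈ z∈Aw =
      let w∈S , w∈T = x∈p∩q⁻ S T (p─q⊆p (S ∩ T) ⁅ v ⁆ w∈)
          w≢v = x∈p-y⇒x≢y w∈
      in x∈p∩q⁺ ( ∈⋃⁺ S _ w∈S (∈-removeFrom A v x z∈Aw (λ w≡v → contradiction w≡v w≢v))
                , ∈⋃⁺ T _ w∈T (∈-removeFrom A v y z∈Aw (λ w≡v → contradiction w≡v w≢v)))

    bound : ∣ S ∣ + ∣ T ∣ ≤ suc (∣ X ∣ + ∣ Y ∣)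
    bound = begin
      ∣ S ∣ + ∣ T ∣                                 ≡⟨ ∣p∪q∣+∣p∩q∣≡∣p∣+∣q∣ S T ⟨
      ∣ S ∪ T ∣ + ∣ S ∩ T ∣                         ≤⟨ +-monoʳ-≤ ∣ S ∪ T ∣ (∣p∣≤1+∣p-x∣ (S ∩ T) v) ⟩
      ∣ S ∪ T ∣ + suc ∣ S ∩ T - v ∣                 ≤⟨ +-mono-≤ (hallA (S ∪ T)) (s≤s (hallA (S ∩ T - v))) ⟩
      ∣ ⋃[ S ∪ T ] A ∣ + suc ∣ ⋃[ S ∩ T - v ] A ∣   ≤⟨ +-mono-≤ (p⊆q⇒∣p∣≤∣q∣ (⋃-⊆ (S ∪ T) A cover))
                                                               (s≤s (p⊆q⇒∣p∣≤∣q∣ (⋃-⊆ (S ∩ T - v) A common))) ⟩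
      ∣ X ∪ Y ∣ + suc ∣ X ∩ Y ∣                     ≡⟨ +-suc ∣ X ∪ Y ∣ ∣ X ∩ Y ∣ ⟩
      suc (∣ X ∪ Y ∣ + ∣ X ∩ Y ∣)                   ≡⟨ cong suc (∣p∪q∣+∣p∩q∣≡∣p∣+∣q∣ X Y) ⟩
      suc (∣ X ∣ + ∣ Y ∣)                           ∎
      where open ≤-Reasoning

  hallCondition-removeFrom : ∀ {x y} → x ≢ y →
    HallCondition (removeFrom A v x) ⊎ HallCondition (removeFrom A v y)
  hallCondition-removeFrom {x} {y} x≢y
    with hallCondition? (removeFrom A v x) | hallCondition? (removeFrom A v y)
  ... | inj₁ hallAx      | _                = inj₁ hallAx
  ... | inj₂ _           | inj₁ hallAy      = inj₂ hallAy
  ... | inj₂ (S , violS) | inj₂ (T , violT) = contradiction violT (violators-incompatible x≢y S T violS)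

hall-singletons : ∀ {A : Fin n → Subset m} → HallCondition A → (∀ v → ∣ A v ∣ ≤ 1) →
                  DistinctRepresentatives A
hall-singletons {n} {m} {A} hallA small = c , c∈A , c-injective
  where
  open ≤-Reasoning

  nonempty : ∀ v → Nonempty (A v)
  nonempty v = ∣p∣>0⇒Nonempty (A v) (begin
    1                    ≡⟨ ∣⁅x⁆∣≡1 v ⟨
    ∣ ⁅ v ⁆ ∣            ≤⟨ hallA ⁅ v ⁆ ⟩
    ∣ ⋃[ ⁅ v ⁆ ] A ∣     ≤⟨ p⊆q⇒∣p∣≤∣q∣ (⋃-⊆ ⁅ v ⁆ A λ w∈⁅v⁆ → ⊆-reflexive (cong A (x∈⁅y⁆⇒x≡y v w∈⁅v⁆))) ⟩
    ∣ A v ∣              ∎)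

  c : Fin n → Fin m
  c v = proj₁ (nonempty v)

  c∈A : ∀ v → c v ∈ A v
  c∈A v = proj₂ (nonempty v)

  A⊆⁅c⁆ : ∀ v → A v ⊆ ⁅ c v ⁆
  A⊆⁅c⁆ v {z} z∈Av with z ≟ c v
  ... | yes refl = x∈⁅x⁆ z
  ... | no  z≢cv = contradiction (small v) (<⇒≱ (twoElements⇒∣p∣>1 z∈Av (c∈A v) z≢cv))

  c-injective : Injective _≡_ _≡_ c
  c-injective {u} {v} cu≡cv with u ≟ v
  ... | yes u≡v = u≡v
  ... | no  u≢v = contradiction (begin-strict
    1                           <⟨ twoElements⇒∣p∣>1 (x∈p∪q⁺ (inj₁ (x∈⁅x⁆ u))) (x∈p∪q⁺ (inj₂ (x∈⁅x⁆ v))) u≢v ⟩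
    ∣ ⁅ u ⁆ ∪ ⁅ v ⁆ ∣           ≤⟨ hallA (⁅ u ⁆ ∪ ⁅ v ⁆) ⟩
    ∣ ⋃[ ⁅ u ⁆ ∪ ⁅ v ⁆ ] A ∣    ≤⟨ p⊆q⇒∣p∣≤∣q∣ (⋃-⊆ (⁅ u ⁆ ∪ ⁅ v ⁆) A inside⁅cu⁆) ⟩
    ∣ ⁅ c u ⁆ ∣                 ≡⟨ ∣⁅x⁆∣≡1 (c u) ⟩
    1                           ∎) (<-irrefl refl)
    where
    inside⁅cu⁆ : ∀ {w} → w ∈ ⁅ u ⁆ ∪ ⁅ v ⁆ → A w ⊆ ⁅ c u ⁆
    inside⁅cu⁆ w∈ with x∈p∪q⁻ ⁅ u ⁆ ⁅ v ⁆ w∈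
    ... | inj₁ w∈⁅u⁆ rewrite x∈⁅y⁆⇒x≡y u w∈⁅u⁆ = A⊆⁅c⁆ u
    ... | inj₂ w∈⁅v⁆ rewrite x∈⁅y⁆⇒x≡y v w∈⁅v⁆ | cu≡cv = A⊆⁅c⁆ v

totalSize : (Fin n → Subset m) → ℕ
totalSize {n = zero}  A = 0
totalSize {n = suc n} A = ∣ A zero ∣ + totalSize (A ∘ suc)

totalSize-mono-≤ : ∀ {A B : Fin n → Subset m} → (∀ v → B v ⊆ A v) → totalSize B ≤ totalSize A
totalSize-mono-≤ {n = zero}  _   = z≤n
totalSize-mono-≤ {n = suc n} B⊆A = +-mono-≤ (p⊆q⇒∣p∣≤∣q∣ (B⊆A zero)) (totalSize-mono-≤ (B⊆A ∘ suc))

totalSize-mono-< : ∀ {A B : Fin n → Subset m} → (∀ v → B v ⊆ A v) →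
                   ∀ v → ∣ B v ∣ < ∣ A v ∣ → totalSize B < totalSize A
totalSize-mono-< B⊆A zero    Bv<Av = +-mono-<-≤ Bv<Av (totalSize-mono-≤ (B⊆A ∘ suc))
totalSize-mono-< B⊆A (suc v) Bv<Av =
  +-mono-≤-< (p⊆q⇒∣p∣≤∣q∣ (B⊆A zero)) (totalSize-mono-< (B⊆A ∘ suc) v Bv<Av)

-- Rado's proof: shrink some list of size at least two while keeping Hall's condition.
hall-acc : ∀ {A : Fin n → Subset m} → Acc _<_ (totalSize A) → HallCondition A →
           DistinctRepresentatives A
hall-acc {A = A} (acc rec) hallA with any? (λ v → 1 <? ∣ A v ∣)
... | no ¬big          = hall-singletons hallA (λ v → ≮⇒≥ (¬big ∘ (v ,_)))
... | yes (v , 1<∣Av∣) =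
  let x , y , x∈Av , y∈Av , x≢y = ∣p∣>1⇒twoElements (A v) 1<∣Av∣
  in [ shrink x∈Av , shrink y∈Av ]′ (hallCondition-removeFrom hallA v x≢y)
  where
  shrink : ∀ {x} → x ∈ A v → HallCondition (removeFrom A v x) → DistinctRepresentatives A
  shrink {x} x∈Av hallAx =
    let c , c∈Ax , c-injective =
          hall-acc (rec (totalSize-mono-< (removeFrom-⊆ A v x) v smaller)) hallAx
    in c , (λ w → removeFrom-⊆ A v x w (c∈Ax w)) , c-injective
    where
    smaller : ∣ removeFrom A v x v ∣ < ∣ A v ∣
    smaller = subst (λ p → ∣ p ∣ < ∣ A v ∣) (sym (updateAt-updates v A)) (x∈p⇒∣p-x∣<∣p∣ x∈Av)

hall : ∀ {A : Fin n → Subset m} → HallCondition A → DistinctRepresentatives A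
hall = hall-acc (<-wellFounded _)

-- Colouring pairs

punchIn-view : ∀ (i j : Fin (suc n)) → j ≡ i ⊎ ∃ λ j′ → j ≡ punchIn i j′
punchIn-view i j with i ≟ j
... | yes i≡j = inj₁ (sym i≡j)
... | no  i≢j = inj₂ (punchOut i≢j , sym (punchIn-punchOut i≢j))

record PairedColouring {k} (A : Fin k → Bool → Subset m) : Set where
  field
    colour              : Fin k → Bool → Fin m
    colour∈             : ∀ i s → colour i s ∈ A i s
    sameColour⇒samePair : ∀ {i j s t} → colour i s ≡ colour j t → i ≡ j

module _ {k} (A : Fin k → Bool → Subset m) (large : ∀ i s → k ≤ ∣ A i s ∣)
         (disjoint : ∀ i → Empty (A i true ∩ A i false)) where

  private
    pair : Fin k → Bool → Fin (k + k)
    pair i true  = i ↑ˡ k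
    pair i false = k ↑ʳ i

    unpair : Fin (k + k) → Fin k × Bool
    unpair v = [ (_, true) , (_, false) ]′ (splitAt k v)

    unpair-pair : ∀ i s → unpair (pair i s) ≡ (i , s)
    unpair-pair i true  = cong [ (_, true) , (_, false) ]′ (splitAt-↑ˡ k i k)
    unpair-pair i false = cong [ (_, true) , (_, false) ]′ (splitAt-↑ʳ k k i)

    B : Fin (k + k) → Subset m
    B = uncurry A ∘ unpair

    B-pair : ∀ i s → B (pair i s) ≡ A i s
    B-pair i s = cong (uncurry A) (unpair-pair i s)

    ⋃-large : ∀ S {v} → v ∈ S → k ≤ ∣ ⋃[ S ] B ∣
    ⋃-large S {v} v∈S = ≤-trans (large _ _) (p⊆q⇒∣p∣≤∣q∣ (∈⋃⁺ S B v∈S))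

    -- A set containing no whole pair has at most k elements; one containing a whole pair
    -- sees the 2k colours of that pair.
    hallB : HallCondition B
    hallB S with Vec.splitAt k S
    ... | Sa , Sb , refl with any? (λ i → i ∈? Sa ×-dec i ∈? Sb)
    ... | yes (i , i∈Sa , i∈Sb) = begin
      ∣ Sa ++ Sb ∣                                      ≤⟨ ∣p∣≤n (Sa ++ Sb) ⟩
      k + k                                             ≤⟨ +-mono-≤ (large i true) (large i false) ⟩
      ∣ A i true ∣ + ∣ A i false ∣                      ≡⟨ disjoint⇒∣p∪q∣≡∣p∣+∣q∣ (disjoint i) ⟨
      ∣ A i true ∪ A i false ∣                          ≤⟨ p⊆q⇒∣p∣≤∣q∣ pair⊆⋃ ⟩
      ∣ ⋃[ Sa ++ Sb ] B ∣                               ∎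
      where
      open ≤-Reasoning
      side∈S : ∀ s → pair i s ∈ Sa ++ Sb
      side∈S true  = ∈-++⁺ˡ Sb i∈Sa
      side∈S false = ∈-++⁺ʳ Sa i∈Sb
      pair⊆⋃ : A i true ∪ A i false ⊆ ⋃[ Sa ++ Sb ] B
      pair⊆⋃ x∈ with x∈p∪q⁻ (A i true) (A i false) x∈
      ... | inj₁ x∈At = ∈⋃⁺ (Sa ++ Sb) B (side∈S true)  (subst (_ ∈_) (sym (B-pair i true))  x∈At)
      ... | inj₂ x∈Af = ∈⋃⁺ (Sa ++ Sb) B (side∈S false) (subst (_ ∈_) (sym (B-pair i false)) x∈Af)
    ... | no ¬whole with nonempty? (Sa ++ Sb)
    ...   | no  empty      = ≤-trans (≤-reflexive (Empty⇒∣p∣≡0 empty)) z≤n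
    ...   | yes (v , v∈S) = begin
      ∣ Sa ++ Sb ∣                  ≡⟨ ∣p++q∣≡∣p∣+∣q∣ Sa Sb ⟩
      ∣ Sa ∣ + ∣ Sb ∣               ≡⟨ disjoint⇒∣p∪q∣≡∣p∣+∣q∣ noWhole ⟨
      ∣ Sa ∪ Sb ∣                   ≤⟨ ∣p∣≤n (Sa ∪ Sb) ⟩
      k                             ≤⟨ ⋃-large (Sa ++ Sb) v∈S ⟩
      ∣ ⋃[ Sa ++ Sb ] B ∣           ∎
      where
      open ≤-Reasoning
      noWhole : Empty (Sa ∩ Sb)
      noWhole (i , i∈Sa∩Sb) = ¬whole (i , x∈p∩q⁻ Sa Sb i∈Sa∩Sb)

  disjointPairedColouring : PairedColouring A
  disjointPairedColouring =
    let c , c∈B , c-injective = hall hallB in record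
      { colour              = λ i s → c (pair i s)
      ; colour∈             = λ i s → subst (c (pair i s) ∈_) (B-pair i s) (c∈B (pair i s))
      ; sameColour⇒samePair = λ {i j s t} same → cong proj₁
          (trans (sym (unpair-pair i s)) (trans (cong unpair (c-injective same)) (unpair-pair j t)))
      }

pairedColouring : ∀ k (A : Fin k → Bool → Subset m) → (∀ i s → k ≤ ∣ A i s ∣) → PairedColouring A
pairedColouring zero    A large = disjointPairedColouring A large λ ()
pairedColouring (suc k) A large with any? (λ i → nonempty? (A i true ∩ A i false))
... | no ¬common = disjointPairedColouring A large λ i common → ¬common (i , common)
... | yes (i , z , z∈Ai) = record { colour = c ; colour∈ = c∈A ; sameColour⇒samePair = c-same }
  where
  A′ : Fin k → Bool → Subset _
  A′ j s = A (punchIn i j) s - z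

  A′-large : ∀ j s → k ≤ ∣ A′ j s ∣
  A′-large j s = s≤s⁻¹ (≤-trans (large (punchIn i j) s) (∣p∣≤1+∣p-x∣ (A (punchIn i j) s) z))

  open PairedColouring (pairedColouring k A′ A′-large)
    renaming (colour to c′; colour∈ to c′∈A′; sameColour⇒samePair to c′-same)

  c : Fin (suc k) → Bool → Fin _
  c = insertAt c′ i (λ _ → z)

  c-i : ∀ s → c i s ≡ z
  c-i s = cong-app (insertAt-lookup c′ i _) s

  c-punchIn : ∀ j s → c (punchIn i j) s ≡ c′ j s
  c-punchIn j s = cong-app (insertAt-punchIn c′ i _ j) s

  c′≢z : ∀ j s → c′ j s ≢ z
  c′≢z j s = x∈p-y⇒x≢y (c′∈A′ j s)

  z∈A : ∀ s → z ∈ A i s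
  z∈A true  = proj₁ (x∈p∩q⁻ (A i true) (A i false) z∈Ai)
  z∈A false = proj₂ (x∈p∩q⁻ (A i true) (A i false) z∈Ai)

  c∈A : ∀ j s → c j s ∈ A j s
  c∈A j s with punchIn-view i j
  ... | inj₁ refl        = subst (_∈ A i s) (sym (c-i s)) (z∈A s)
  ... | inj₂ (j′ , refl) = subst (_∈ A _ s) (sym (c-punchIn j′ s)) (p─q⊆p _ ⁅ z ⁆ (c′∈A′ j′ s))

  c-same : ∀ {j l s t} → c j s ≡ c l t → j ≡ l
  c-same {j} {l} {s} {t} eq with punchIn-view i j | punchIn-view i l
  ... | inj₁ refl        | inj₁ refl        = refl
  ... | inj₁ refl        | inj₂ (l′ , refl) =
    contradiction (trans (sym (c-punchIn l′ t)) (trans (sym eq) (c-i s))) (c′≢z l′ t)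
  ... | inj₂ (j′ , refl) | inj₁ refl        =
    contradiction (trans (sym (c-punchIn j′ s)) (trans eq (c-i t))) (c′≢z j′ s)
  ... | inj₂ (j′ , refl) | inj₂ (l′ , refl) =
    cong (punchIn i) (c′-same (trans (sym (c-punchIn j′ s)) (trans eq (c-punchIn l′ t))))

Unique-reverse : ∀ {A : Set} {xs : List A} → Unique xs → Unique (List.reverse xs)
Unique-reverse {A} {xs} = Permutationₛ.Unique-resp-↭ (setoid A) (↭⇒↭ₛ (↭-sym (↭-reverse xs)))

Unique-applyUpTo⁻ : ∀ {A : Set} (f : ℕ → A) {t} → Unique (applyUpTo f t) →
                    ∀ {i j} → i < j → j < t → f i ≢ f j
Unique-applyUpTo⁻ f {suc t} (f0∉ ∷ _)   {zero}  {suc j} _   j<t =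
  All.lookup f0∉ (∈-applyUpTo⁺ (f ∘ suc) (s≤s⁻¹ j<t))
Unique-applyUpTo⁻ f {suc t} (_ ∷ !rest) {suc i} {suc j} i<j j<t =
  Unique-applyUpTo⁻ (f ∘ suc) !rest (s≤s⁻¹ i<j) (s≤s⁻¹ j<t)

length≤∣p∣ : ∀ (p : Subset n) {xs : List ℕ} → Unique xs →
             (∀ {x} → x ∈ₗ xs → ∃ λ z → toℕ z ≡ x × z ∈ p) → length xs ≤ ∣ p ∣
length≤∣p∣ p []            _     = z≤n
length≤∣p∣ p (x∉xs ∷ !xs) inP with inP (here refl)
... | z , refl , z∈p = ≤-trans (s≤s (length≤∣p∣ (p - z) !xs inP-z)) (x∈p⇒∣p-x∣<∣p∣ z∈p)
  where
  inP-z : ∀ {y} → y ∈ₗ _ → ∃ λ w → toℕ w ≡ y × w ∈ p - z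
  inP-z y∈xs with inP (there y∈xs)
  ... | w , refl , w∈p = w , refl , x∈p∧x≢y⇒x∈p-y w∈p λ { refl → All.lookup x∉xs y∈xs refl }

unique-length≤ : ∀ {r} {xs : List ℕ} → Unique xs → (∀ {x} → x ∈ₗ xs → x < r) → length xs ≤ r
unique-length≤ {r} !xs below =
  subst (_ ≤_) (∣⊤∣≡n r) (length≤∣p∣ ⊤ !xs λ x∈ → fromℕ< (below x∈) , toℕ-fromℕ< _ , ∈⊤)

full-unique⇒∈ : ∀ {r y} {xs : List ℕ} → Unique xs → (∀ {x} → x ∈ₗ xs → x < r) → length xs ≡ r →
                y < r → y ∈ₗ xs
full-unique⇒∈ {r} {y} {xs} !xs below len y<r with y ∈ₗ? xs
... | yes y∈xs = y∈xs
... | no  y∉xs = contradiction (begin-strict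
  r                         ≡⟨ len ⟨
  length xs                 ≤⟨ length≤∣p∣ (⊤ - ŷ) !xs avoids-ŷ ⟩
  ∣ ⊤ - ŷ ∣                 <⟨ x∈p⇒∣p-x∣<∣p∣ (∈⊤ {x = ŷ}) ⟩
  ∣ ⊤ {r} ∣                 ≡⟨ ∣⊤∣≡n r ⟩
  r                         ∎) (<-irrefl refl)
  where
  open ≤-Reasoning
  ŷ = fromℕ< y<r
  avoids-ŷ : ∀ {x} → x ∈ₗ xs → ∃ λ z → toℕ z ≡ x × z ∈ ⊤ - ŷ
  avoids-ŷ {x} x∈xs = fromℕ< (below x∈xs) , toℕ-fromℕ< _ , x∈p∧x≢y⇒x∈p-y ∈⊤ λ x̂≡ŷ →
    y∉xs (subst (_∈ₗ xs) (trans (sym (toℕ-fromℕ< _)) (trans (cong toℕ x̂≡ŷ) (toℕ-fromℕ< y<r))) x∈xs)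

module _ {G : Graph} where

  snoc : ∀ {u v w} → Walk G u v → ∀ e → Joins G e v w → Walk G u w
  snoc []             e j = step e j []
  snoc (step e′ j′ p) e j = step e′ j′ (snoc p e j)

  reverse : ∀ {u w} → Walk G u w → Walk G w u
  reverse []           = []
  reverse (step e j p) = snoc (reverse p) e (swap j)

  walkEdges-snoc : ∀ {u v w} (p : Walk G u v) e (j : Joins G e v w) →
                   walkEdges G (snoc p e j) ≡ walkEdges G p ∷ʳ e
  walkEdges-snoc []             e j = refl
  walkEdges-snoc (step e′ j′ p) e j = cong (e′ ∷_) (walkEdges-snoc p e j)

  walkVertices-snoc : ∀ {u v w} (p : Walk G u v) e (j : Joins G e v w) →
                      walkVertices G (snoc p e j) ≡ walkVertices G p ∷ʳ w
  walkVertices-snoc []             e j = refl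
  walkVertices-snoc {u} (step e′ j′ p) e j = cong (u ∷_) (walkVertices-snoc p e j)

  walkEdges-reverse : ∀ {u w} (p : Walk G u w) → walkEdges G (reverse p) ≡ List.reverse (walkEdges G p)
  walkEdges-reverse []           = refl
  walkEdges-reverse (step e j p) = begin
    walkEdges G (snoc (reverse p) e (swap j)) ≡⟨ walkEdges-snoc (reverse p) e (swap j) ⟩
    walkEdges G (reverse p) ∷ʳ e              ≡⟨ cong (_∷ʳ e) (walkEdges-reverse p) ⟩
    List.reverse (walkEdges G p) ∷ʳ e         ≡⟨ unfold-reverse e (walkEdges G p) ⟨
    List.reverse (e ∷ walkEdges G p)          ∎
    where open ≡-Reasoning

  walkVertices-reverse : ∀ {u w} (p : Walk G u w) →
                         walkVertices G (reverse p) ≡ List.reverse (walkVertices G p)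
  walkVertices-reverse []               = refl
  walkVertices-reverse {u} (step e j p) = begin
    walkVertices G (snoc (reverse p) e (swap j)) ≡⟨ walkVertices-snoc (reverse p) e (swap j) ⟩
    walkVertices G (reverse p) ∷ʳ u              ≡⟨ cong (_∷ʳ u) (walkVertices-reverse p) ⟩
    List.reverse (walkVertices G p) ∷ʳ u         ≡⟨ unfold-reverse u (walkVertices G p) ⟨
    List.reverse (u ∷ walkVertices G p)          ∎
    where open ≡-Reasoning

  walkLength-reverse : ∀ {u w} (p : Walk G u w) → walkLength G (reverse p) ≡ walkLength G p
  walkLength-reverse p = trans (cong length (walkEdges-reverse p)) (length-reverse (walkEdges G p))

  IsPath-reverse : ∀ {u w} {p : Walk G u w} → IsPath G p → IsPath G (reverse p)
  IsPath-reverse {p = p} = subst Unique (sym (walkVertices-reverse p)) ∘ Unique-reverse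

  IsRainbow-reverse : ∀ {u w} c {p : Walk G u w} → IsRainbow G c p → IsRainbow G c (reverse p)
  IsRainbow-reverse c {p} rainbow = subst Unique colours-reverse (Unique-reverse rainbow)
    where
    colours-reverse : List.reverse (List.map c (walkEdges G p)) ≡ List.map c (walkEdges G (reverse p))
    colours-reverse =
      trans (sym (reverse-map c (walkEdges G p))) (cong (List.map c) (sym (walkEdges-reverse p)))

  IsGeodesic-reverse : ∀ {u w} {p : Walk G u w} → IsGeodesic G p → IsGeodesic G (reverse p)
  IsGeodesic-reverse {p = p} (path , shortest) = IsPath-reverse path , λ q q-path → begin
    walkLength G (reverse p) ≡⟨ walkLength-reverse p ⟩
    walkLength G p           ≤⟨ shortest (reverse q) (IsPath-reverse q-path) ⟩
    walkLength G (reverse q) ≡⟨ walkLength-reverse q ⟩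
    walkLength G q           ∎
    where open ≤-Reasoning

  rainbow-length≤ : ∀ {r c u w} (p : Walk G u w) → (∀ e → c e < r) → IsRainbow G c p →
                    walkLength G p ≤ r
  rainbow-length≤ {r} {c} p c<r rainbow =
    subst (_≤ r) (length-map c (walkEdges G p)) (unique-length≤ rainbow below)
    where
    below : ∀ {x} → x ∈ₗ List.map c (walkEdges G p) → x < r
    below x∈ = let e , _ , x≡ce = ∈-map⁻ c x∈ in subst (_< r) (sym x≡ce) (c<r e)

StronglyRainbowConnected⇒RainbowConnected : ∀ {G c} → StronglyRainbowConnected G c → RainbowConnected G c
StronglyRainbowConnected⇒RainbowConnected src u w =
  let p , (p-path , _) , p-rainbow = src u w in p , p-path , p-rainbow

ListChoosable-mono : ∀ {G P Q r} → (∀ {c} → P c → Q c) → ListChoosable G P r → ListChoosable G Q r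
ListChoosable-mono P⇒Q choosable L = let c , c∈L , Pc = choosable L in c , c∈L , P⇒Q Pc

upToLists : ∀ {G} r → ListAssignment G r
upToLists r = record
  { lists    = λ _ → List.upTo r
  ; distinct = λ _ → upTo⁺ r
  ; large    = λ _ → ≤-reflexive (sym (length-upTo r))
  }

module _ {G : Graph} {r} (L : ListAssignment G r) where

  paletteSize : ℕ
  paletteSize = suc (max 0 (List.concatMap (lists L) (List.allFin (E G))))

  lists<paletteSize : ∀ {e x} → x ∈ₗ lists L e → x < paletteSize
  lists<paletteSize {e} x∈ =
    s≤s (All.lookup (xs≤max 0 _) (∈-concat⁺′ x∈ (∈-map⁺ (lists L) (∈-allFin e))))

  palette : Fin (E G) → Subset paletteSize
  palette e = tabulate (λ z → does (toℕ z ∈ₗ? lists L e))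

  ∈palette⁻ : ∀ {e z} → z ∈ palette e → toℕ z ∈ₗ lists L e
  ∈palette⁻ {e} {z} z∈
    with toℕ z ∈ₗ? lists L e | ∈-tabulate⁻ {f = λ z → does (toℕ z ∈ₗ? lists L e)} z∈
  ... | yes x∈ | _  = x∈
  ... | no  _  | ()

  ∈palette⁺ : ∀ {e z} → toℕ z ∈ₗ lists L e → z ∈ palette e
  ∈palette⁺ {e} {z} x∈ with toℕ z ∈ₗ? lists L e in eq
  ... | yes _  = ∈-tabulate⁺ {f = λ z → does (toℕ z ∈ₗ? lists L e)} (cong does eq)
  ... | no x∉ = contradiction x∈ x∉

  r≤∣palette∣ : ∀ e → r ≤ ∣ palette e ∣
  r≤∣palette∣ e = ≤-trans (large L e) (length≤∣p∣ (palette e) (distinct L e) λ x∈ →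
    let x<M = lists<paletteSize x∈
    in fromℕ< x<M , toℕ-fromℕ< x<M , ∈palette⁺ (subst (_∈ₗ lists L e) (sym (toℕ-fromℕ< x<M)) x∈))

-- The cycle

⌈n/2⌉≡⌊n/2⌋∨⌈n/2⌉≡1+⌊n/2⌋ : ∀ n → ⌈ n /2⌉ ≡ ⌊ n /2⌋ ⊎ ⌈ n /2⌉ ≡ suc ⌊ n /2⌋
⌈n/2⌉≡⌊n/2⌋∨⌈n/2⌉≡1+⌊n/2⌋ zero          = inj₁ refl
⌈n/2⌉≡⌊n/2⌋∨⌈n/2⌉≡1+⌊n/2⌋ (suc zero)    = inj₂ refl
⌈n/2⌉≡⌊n/2⌋∨⌈n/2⌉≡1+⌊n/2⌋ (suc (suc n)) =
  Sum.map (cong suc) (cong suc) (⌈n/2⌉≡⌊n/2⌋∨⌈n/2⌉≡1+⌊n/2⌋ n)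

toℕ-next : ∀ .{{_ : NonZero n}} (u : Fin n) → toℕ (next u) ≡ suc (toℕ u) % n
toℕ-next {suc m} u = toℕ-fromℕ< _

module OnCycle (n : ℕ) .{{_ : NonZero n}} where

  C : Graph
  C = Cycle n

  0<n : 0 < n
  0<n = >-nonZero⁻¹ n

  origin : Fin n
  origin = fromℕ< 0<n

  advance : ℕ → Fin n → Fin n
  advance zero    u = u
  advance (suc t) u = advance t (next u)

  advance-+ : ∀ s t u → advance (s + t) u ≡ advance t (advance s u)
  advance-+ zero    t u = refl
  advance-+ (suc s) t u = advance-+ s t (next u)

  private
    [a%n+b]%n≡[a+b]%n : ∀ a b → (a % n + b) % n ≡ (a + b) % n
    [a%n+b]%n≡[a+b]%n a b = begin
      (a % n + b) % n         ≡⟨ %-distribˡ-+ (a % n) b n ⟩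
      (a % n % n + b % n) % n ≡⟨ cong (λ x → (x + b % n) % n) (m%n%n≡m%n a n) ⟩
      (a % n + b % n) % n     ≡⟨ %-distribˡ-+ a b n ⟨
      (a + b) % n             ∎
      where open ≡-Reasoning

    [a+b%n]%n≡[a+b]%n : ∀ a b → (a + b % n) % n ≡ (a + b) % n
    [a+b%n]%n≡[a+b]%n a b =
      trans (cong (_% n) (+-comm a (b % n))) (trans ([a%n+b]%n≡[a+b]%n b a) (cong (_% n) (+-comm b a)))

    u+[n∸u]≡n : ∀ (u : Fin n) → toℕ u + (n ∸ toℕ u) ≡ n
    u+[n∸u]≡n u = m+[n∸m]≡n (<⇒≤ (toℕ<n u))

  toℕ-advance : ∀ t u → toℕ (advance t u) ≡ (toℕ u + t) % n
  toℕ-advance zero    u = sym (trans (cong (_% n) (+-identityʳ (toℕ u))) (m<n⇒m%n≡m (toℕ<n u)))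
  toℕ-advance (suc t) u = begin
    toℕ (advance t (next u))  ≡⟨ toℕ-advance t (next u) ⟩
    (toℕ (next u) + t) % n    ≡⟨ cong (λ x → (x + t) % n) (toℕ-next u) ⟩
    (suc (toℕ u) % n + t) % n ≡⟨ [a%n+b]%n≡[a+b]%n (suc (toℕ u)) t ⟩
    (suc (toℕ u) + t) % n     ≡⟨ cong (_% n) (+-suc (toℕ u) t) ⟨
    (toℕ u + suc t) % n       ∎
    where open ≡-Reasoning

  advance-toℕ : ∀ t u w → toℕ w ≡ toℕ u + t → advance t u ≡ w
  advance-toℕ t u w eq =
    toℕ-injective (trans (toℕ-advance t u) (trans (cong (_% n) (sym eq)) (m<n⇒m%n≡m (toℕ<n w))))

  advance-origin : ∀ e → advance (toℕ e) origin ≡ e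
  advance-origin e = advance-toℕ (toℕ e) origin e (sym (cong (_+ toℕ e) (toℕ-fromℕ< 0<n)))

  advance-n : ∀ u → advance n u ≡ u
  advance-n u = toℕ-injective
    (trans (toℕ-advance n u) (trans ([m+n]%n≡m%n (toℕ u) n) (m<n⇒m%n≡m (toℕ<n u))))

  -- the t < n with advance t u ≡ w
  offset : Fin n → Fin n → ℕ
  offset u w = (toℕ w + (n ∸ toℕ u)) % n

  offset<n : ∀ u w → offset u w < n
  offset<n u w = m%n<n (toℕ w + (n ∸ toℕ u)) n

  advance-offset : ∀ u w → advance (offset u w) u ≡ w
  advance-offset u w = toℕ-injective (begin
    toℕ (advance (offset u w) u)             ≡⟨ toℕ-advance (offset u w) u ⟩
    (toℕ u + offset u w) % n                 ≡⟨ [a+b%n]%n≡[a+b]%n (toℕ u) _ ⟩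
    (toℕ u + (toℕ w + (n ∸ toℕ u))) % n      ≡⟨ cong (_% n) (x∙yz≈y∙xz (toℕ u) (toℕ w) _) ⟩
    (toℕ w + (toℕ u + (n ∸ toℕ u))) % n      ≡⟨ cong (λ x → (toℕ w + x) % n) (u+[n∸u]≡n u) ⟩
    (toℕ w + n) % n                          ≡⟨ [m+n]%n≡m%n (toℕ w) n ⟩
    toℕ w % n                                ≡⟨ m<n⇒m%n≡m (toℕ<n w) ⟩
    toℕ w                                    ∎)
    where open ≡-Reasoning

  offset-advance : ∀ u {t} → t < n → offset u (advance t u) ≡ t
  offset-advance u {t} t<n = begin
    (toℕ (advance t u) + (n ∸ toℕ u)) % n    ≡⟨ cong (λ x → (x + (n ∸ toℕ u)) % n) (toℕ-advance t u) ⟩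
    ((toℕ u + t) % n + (n ∸ toℕ u)) % n      ≡⟨ [a%n+b]%n≡[a+b]%n (toℕ u + t) _ ⟩
    (toℕ u + t + (n ∸ toℕ u)) % n            ≡⟨ cong (_% n) (+-assoc (toℕ u) t _) ⟩
    (toℕ u + (t + (n ∸ toℕ u))) % n          ≡⟨ cong (_% n) (x∙yz≈y∙xz (toℕ u) t _) ⟩
    (t + (toℕ u + (n ∸ toℕ u))) % n          ≡⟨ cong (λ x → (t + x) % n) (u+[n∸u]≡n u) ⟩
    (t + n) % n                              ≡⟨ [m+n]%n≡m%n t n ⟩
    t % n                                    ≡⟨ m<n⇒m%n≡m t<n ⟩
    t                                        ∎
    where open ≡-Reasoning

  advance-injective : ∀ u {i j} → i < n → j < n → advance i u ≡ advance j u → i ≡ j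
  advance-injective u i<n j<n eq =
    trans (sym (offset-advance u i<n)) (trans (cong (offset u) eq) (offset-advance u j<n))

  -- the length of the shorter of the two arcs spanning t consecutive edges
  ‖_‖ : ℕ → ℕ
  ‖ t ‖ = t ⊓ (n ∸ t)

  distance : Fin n → Fin n → ℕ
  distance u w = ‖ offset u w ‖

  ‖1+t‖≤1+‖t‖ : ∀ t → ‖ suc t ‖ ≤ suc ‖ t ‖
  ‖1+t‖≤1+‖t‖ t = ⊓-monoʳ-≤ (suc t) (≤-trans (∸-monoʳ-≤ n (n≤1+n t)) (n≤1+n (n ∸ t)))

  ‖t‖≤1+‖1+t‖ : ∀ t → ‖ t ‖ ≤ suc ‖ suc t ‖
  ‖t‖≤1+‖1+t‖ t = ⊓-mono-≤ (≤-trans (n≤1+n t) (n≤1+n (suc t))) (m≤n+o⇒m∸n≤o n t n≤t+[1+n∸[1+t]])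
    where
    n≤t+[1+n∸[1+t]] : n ≤ t + suc (n ∸ suc t)
    n≤t+[1+n∸[1+t]] = subst (n ≤_) (sym (+-suc t (n ∸ suc t))) (m≤n+m∸n n (suc t))

  s≤‖t‖ : ∀ {s t} → s ≤ t → s + t ≤ n → s ≤ ‖ t ‖
  s≤‖t‖ {s} s≤t s+t≤n = ⊓-glb s≤t (m+n≤o⇒m≤o∸n s s+t≤n)

  ‖t‖≡t : ∀ {t} → t + t ≤ n → ‖ t ‖ ≡ t
  ‖t‖≡t {t} t+t≤n = ≤-antisym (m⊓n≤m t (n ∸ t)) (s≤‖t‖ ≤-refl t+t≤n)

  private
    ‖offset‖-step : ∀ a t → t < n →
      ‖ offset a (advance (suc t) a) ‖ ≤ suc ‖ t ‖ × ‖ t ‖ ≤ suc ‖ offset a (advance (suc t) a) ‖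
    ‖offset‖-step a t t<n with m≤n⇒m<n∨m≡n t<n
    ... | inj₁ 1+t<n rewrite offset-advance a 1+t<n = ‖1+t‖≤1+‖t‖ t , ‖t‖≤1+‖1+t‖ t
    ... | inj₂ 1+t≡n =
      subst (λ s → ‖ s ‖ ≤ suc ‖ t ‖ × ‖ t ‖ ≤ suc ‖ s ‖) (sym offset≡0)
        (z≤n , ≤-trans (m⊓n≤n t (n ∸ t)) (≤-reflexive (trans (cong (_∸ t) (sym 1+t≡n)) (m+n∸n≡m 1 t))))
      where
      offset≡0 : offset a (advance (suc t) a) ≡ 0
      offset≡0 = trans (cong (offset a) (trans (cong (λ s → advance s a) 1+t≡n) (advance-n a)))
                       (offset-advance a 0<n)

  distance-next : ∀ a b →
                  distance a b ≤ suc (distance (next a) b) × distance (next a) b ≤ suc (distance a b)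
  distance-next a b = subst (λ w → ‖ offset a w ‖ ≤ suc ‖ t ‖ × ‖ t ‖ ≤ suc ‖ offset a w ‖)
                            (advance-offset (next a) b) (‖offset‖-step a t (offset<n (next a) b))
    where t = offset (next a) b

  distance≤walkLength : ∀ {a b} (p : Walk C a b) → distance a b ≤ walkLength C p
  distance≤walkLength {a} []                             = ≤-reflexive (cong ‖_‖ (offset-advance a 0<n))
  distance≤walkLength {a} {b} (step e (inj₁ refl) p) =
    ≤-trans (proj₁ (distance-next a b)) (s≤s (distance≤walkLength p))
  distance≤walkLength {b = b} (step e (inj₂ refl) p) =
    ≤-trans (proj₂ (distance-next e b)) (s≤s (distance≤walkLength p))

  ‖t‖≤walkLength : ∀ {u w} t → t < n → advance t u ≡ w → (p : Walk C u w) → ‖ t ‖ ≤ walkLength C p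
  ‖t‖≤walkLength {u} t t<n end p =
    subst (λ s → ‖ s ‖ ≤ walkLength C p) (trans (cong (offset u) (sym end)) (offset-advance u t<n))
          (distance≤walkLength p)

  arc : ∀ u t → Walk C u (advance t u)
  arc u zero    = []
  arc u (suc t) = step u (inj₁ refl) (arc (next u) t)

  walkLength-arc : ∀ u t → walkLength C (arc u t) ≡ t
  walkLength-arc u zero    = refl
  walkLength-arc u (suc t) = cong suc (walkLength-arc (next u) t)

  walkVertices-arc : ∀ u t → walkVertices C (arc u t) ≡ applyUpTo (λ j → advance j u) (suc t)
  walkVertices-arc u zero    = refl
  walkVertices-arc u (suc t) = cong (u ∷_) (walkVertices-arc (next u) t)

  colours-arc : ∀ (c : Fin n → ℕ) u t →
                List.map c (walkEdges C (arc u t)) ≡ applyUpTo (λ j → c (advance j u)) t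
  colours-arc c u zero    = refl
  colours-arc c u (suc t) = cong (c u ∷_) (colours-arc c (next u) t)

  arc-IsPath : ∀ u {t} → t < n → IsPath C (arc u t)
  arc-IsPath u {t} t<n =
    subst Unique (sym (walkVertices-arc u t)) (applyUpTo⁺₁ _ (suc t) vertices-distinct)
    where
    vertices-distinct : ∀ {i j} → i < j → j < suc t → advance i u ≢ advance j u
    vertices-distinct i<j j<1+t = <⇒≢ i<j ∘ advance-injective u (<-trans i<j j<n) j<n
      where j<n = ≤-<-trans (s≤s⁻¹ j<1+t) t<n

  t+t≤n⇒t<n : ∀ {t} → t + t ≤ n → t < n
  t+t≤n⇒t<n {zero}  _     = 0<n
  t+t≤n⇒t<n {suc t} 2t≤n = ≤-trans (s≤s (m≤n+m (suc t) t)) 2t≤n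

  arc-IsGeodesic : ∀ u {t} → t + t ≤ n → IsGeodesic C (arc u t)
  arc-IsGeodesic u {t} 2t≤n = arc-IsPath u (t+t≤n⇒t<n 2t≤n) , λ q _ → begin
    walkLength C (arc u t) ≡⟨ walkLength-arc u t ⟩
    t                      ≡⟨ ‖t‖≡t 2t≤n ⟨
    ‖ t ‖                  ≤⟨ ‖t‖≤walkLength t (t+t≤n⇒t<n 2t≤n) refl q ⟩
    walkLength C q         ∎
    where open ≤-Reasoning

  arc-unique : ∀ {a b} t (p : Walk C a b) → advance t a ≡ b → walkLength C p ≡ t → t + t < n →
               walkEdges C p ≡ walkEdges C (arc a t)
  arc-unique zero    []                     _   _   _    = refl
  arc-unique (suc t) (step e (inj₁ refl) p) end len 2t<n =
    cong (e ∷_) (arc-unique t p end (suc-injective len) (<-trans (+-mono-< (n<1+n t) (n<1+n t)) 2t<n))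
  arc-unique (suc t) (step e (inj₂ refl) p) end len 2t<n = contradiction (begin
    suc t                 ≤⟨ s≤‖t‖ (n≤1+n (suc t)) (subst (_≤ n) (sym (+-suc (suc t) (suc t))) 2t<n) ⟩
    ‖ suc (suc t) ‖       ≤⟨ ‖t‖≤walkLength (suc (suc t)) (≤-<-trans (s≤s (m≤n+m (suc t) t)) 2t<n) end p ⟩
    walkLength C p        ≡⟨ suc-injective len ⟩
    t                     ∎) 1+n≰n
    where open ≤-Reasoning

  diameter : ℕ
  diameter = ⌊ n /2⌋

  diameter+diameter≤n : diameter + diameter ≤ n
  diameter+diameter≤n = ≤-trans (+-monoʳ-≤ diameter (⌊n/2⌋≤⌈n/2⌉ n)) (≤-reflexive (⌊n/2⌋+⌈n/2⌉≡n n))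

  t+t≤n⇒t≤diameter : ∀ {t} → t + t ≤ n → t ≤ diameter
  t+t≤n⇒t≤diameter {t} 2t≤n = subst (_≤ diameter) (sym (n≡⌊n+n/2⌋ t)) (⌊n/2⌋-mono 2t≤n)

  OnlyAntipodalRepeats : (Fin n → ℕ) → Set
  OnlyAntipodalRepeats c =
    ∀ e e′ → c e ≡ c e′ → e ≡ e′ ⊎ e′ ≡ advance diameter e ⊎ e ≡ advance diameter e′

  arc-IsRainbow : ∀ {c} → OnlyAntipodalRepeats c → ∀ u {t} → t ≤ diameter → IsRainbow C c (arc u t)
  arc-IsRainbow {c} repeats u {t} t≤d =
    subst Unique (sym (colours-arc c u t)) (applyUpTo⁺₁ _ t colours-distinct)
    where
    d = diameter

    x+d<n : ∀ {x} → x < d → x + d < n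
    x+d<n x<d = <-≤-trans (+-monoˡ-< d x<d) diameter+diameter≤n

    x<d⇒x<n : ∀ {x} → x < d → x < n
    x<d⇒x<n x<d = <-≤-trans x<d (≤-trans (m≤m+n d d) diameter+diameter≤n)

    colours-distinct : ∀ {i j} → i < j → j < t → c (advance i u) ≢ c (advance j u)
    colours-distinct {i} {j} i<j j<t same = excluded (repeats _ _ same)
      where
      j<d = <-≤-trans j<t t≤d
      i<d = <-trans i<j j<d
      excluded : ¬ (advance i u ≡ advance j u ⊎ advance j u ≡ advance d (advance i u)
                    ⊎ advance i u ≡ advance d (advance j u))
      excluded (inj₁ i≡j) = <⇒≢ i<j (advance-injective u (x<d⇒x<n i<d) (x<d⇒x<n j<d) i≡j)
      excluded (inj₂ (inj₁ j-opposite)) = <⇒≢ (<-≤-trans j<d (m≤n+m d i))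
        (advance-injective u (x<d⇒x<n j<d) (x+d<n i<d) (trans j-opposite (sym (advance-+ i d u))))
      excluded (inj₂ (inj₂ i-opposite)) = <⇒≢ (<-≤-trans i<d (m≤n+m d j))
        (advance-injective u (x<d⇒x<n i<d) (x+d<n j<d) (trans i-opposite (sym (advance-+ j d u))))

  RainbowGeodesic : (Fin n → ℕ) → Fin n → Fin n → Set
  RainbowGeodesic c u w = Σ (Walk C u w) λ p → IsGeodesic C p × IsRainbow C c p

  arc-RainbowGeodesic : ∀ {c} → OnlyAntipodalRepeats c → ∀ u t → t + t ≤ n →
                        RainbowGeodesic c u (advance t u)
  arc-RainbowGeodesic {c} repeats u t 2t≤n =
    arc u t , arc-IsGeodesic u 2t≤n , arc-IsRainbow {c} repeats u (t+t≤n⇒t≤diameter 2t≤n)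

  stronglyRainbowConnected : ∀ {c} → OnlyAntipodalRepeats c → StronglyRainbowConnected C c
  stronglyRainbowConnected {c} repeats u w with offset u w + offset u w ≤? n
  ... | yes 2t≤n =
    subst (RainbowGeodesic c u) (advance-offset u w) (arc-RainbowGeodesic {c} repeats u (offset u w) 2t≤n)
  ... | no  2t≰n =
    let p , p-geodesic , p-rainbow =
          subst (RainbowGeodesic c w) back (arc-RainbowGeodesic {c} repeats w s 2s≤n)
    in reverse p , IsGeodesic-reverse p-geodesic , IsRainbow-reverse c p-rainbow
    where
    t = offset u w
    s = n ∸ t

    t+s≡n : t + s ≡ n
    t+s≡n = m+[n∸m]≡n (<⇒≤ (offset<n u w))

    back : advance s w ≡ u
    back = begin
      advance s w             ≡⟨ cong (advance s) (advance-offset u w) ⟨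
      advance s (advance t u) ≡⟨ advance-+ t s u ⟨
      advance (t + s) u       ≡⟨ cong (λ x → advance x u) t+s≡n ⟩
      advance n u             ≡⟨ advance-n u ⟩
      u                       ∎
      where open ≡-Reasoning

    s<t : s < t
    s<t = +-cancelˡ-< t s t (subst (_< t + t) (sym t+s≡n) (≰⇒> 2t≰n))

    2s≤n : s + s ≤ n
    2s≤n = subst (s + s ≤_) t+s≡n (+-monoˡ-≤ s (<⇒≤ s<t))

  -- For odd n the edge diameter lies in two pairs.
  pairEdge : Fin ⌈ n /2⌉ → Bool → Fin n
  pairEdge i true  = advance (toℕ i) origin
  pairEdge i false = advance diameter (advance (toℕ i) origin)

  pairEdge-antipodal : ∀ i s t → pairEdge i s ≡ pairEdge i t
                                 ⊎ pairEdge i t ≡ advance diameter (pairEdge i s)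
                                 ⊎ pairEdge i s ≡ advance diameter (pairEdge i t)
  pairEdge-antipodal i true  true  = inj₁ refl
  pairEdge-antipodal i false false = inj₁ refl
  pairEdge-antipodal i true  false = inj₂ (inj₁ refl)
  pairEdge-antipodal i false true  = inj₂ (inj₂ refl)

  private
    ⌈n/2⌉≤e⇒e∸diameter<⌈n/2⌉ : ∀ (e : Fin n) → ⌈ n /2⌉ ≤ toℕ e → toℕ e ∸ diameter < ⌈ n /2⌉
    ⌈n/2⌉≤e⇒e∸diameter<⌈n/2⌉ e ⌈n/2⌉≤e =
      subst (toℕ e ∸ diameter <_) (trans (cong (_∸ diameter) (sym (⌊n/2⌋+⌈n/2⌉≡n n))) (m+n∸m≡n diameter _))
            (∸-monoˡ-< (toℕ<n e) (≤-trans (⌊n/2⌋≤⌈n/2⌉ n) ⌈n/2⌉≤e))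

  pairOf : Fin n → Fin ⌈ n /2⌉ × Bool
  pairOf e with toℕ e <? ⌈ n /2⌉
  ... | yes e<⌈n/2⌉ = fromℕ< e<⌈n/2⌉ , true
  ... | no  e≮⌈n/2⌉ = fromℕ< (⌈n/2⌉≤e⇒e∸diameter<⌈n/2⌉ e (≮⇒≥ e≮⌈n/2⌉)) , false

  pairEdge-pairOf : ∀ e → uncurry pairEdge (pairOf e) ≡ e
  pairEdge-pairOf e with toℕ e <? ⌈ n /2⌉
  ... | yes e<⌈n/2⌉ = trans (cong (λ t → advance t origin) (toℕ-fromℕ< e<⌈n/2⌉)) (advance-origin e)
  ... | no  e≮⌈n/2⌉ = begin
    advance diameter (advance (toℕ (fromℕ< e∸d<⌈n/2⌉)) origin) ≡⟨ cong (λ t → advance diameter (advance t origin))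
                                                                   (toℕ-fromℕ< e∸d<⌈n/2⌉) ⟩
    advance diameter (advance (toℕ e ∸ diameter) origin)   ≡⟨ advance-+ (toℕ e ∸ diameter) diameter origin ⟨
    advance (toℕ e ∸ diameter + diameter) origin           ≡⟨ cong (λ t → advance t origin) (m∸n+n≡m d≤e) ⟩
    advance (toℕ e) origin                                 ≡⟨ advance-origin e ⟩
    e                                                      ∎
    where
    open ≡-Reasoning
    d≤e = ≤-trans (⌊n/2⌋≤⌈n/2⌉ n) (≮⇒≥ e≮⌈n/2⌉)
    e∸d<⌈n/2⌉ = ⌈n/2⌉≤e⇒e∸diameter<⌈n/2⌉ e (≮⇒≥ e≮⌈n/2⌉)

  antipodalLColouring : (L : ListAssignment C ⌈ n /2⌉) →
                        Σ (EdgeColouring C) λ c → IsLColouring C L c × OnlyAntipodalRepeats c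
  antipodalLColouring L = c , c∈L , c-repeats
    where
    open PairedColouring (pairedColouring ⌈ n /2⌉ (λ i s → palette L (pairEdge i s))
                                                   (λ i s → r≤∣palette∣ L (pairEdge i s)))

    c : Fin n → ℕ
    c e = toℕ (uncurry colour (pairOf e))

    c∈L : IsLColouring C L c
    c∈L e = ∈palette⁻ L (subst (λ e′ → uncurry colour (pairOf e) ∈ palette L e′) (pairEdge-pairOf e)
                               (uncurry colour∈ (pairOf e)))

    c-repeats : OnlyAntipodalRepeats c
    c-repeats e e′ same
      with pairOf e | pairOf e′ | pairEdge-pairOf e | pairEdge-pairOf e′ | toℕ-injective same
    ... | i , s | j , t | refl | refl | same-colour with sameColour⇒samePair same-colour
    ... | refl = pairEdge-antipodal i s t

  upperBound : ListChoosable C (StronglyRainbowConnected C) ⌈ n /2⌉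
  upperBound L =
    let c , c∈L , repeats = antipodalLColouring L in c , c∈L , stronglyRainbowConnected repeats

  diameter≤ : ∀ {r c} → (∀ e → c e < r) → RainbowConnected C c → diameter ≤ r
  diameter≤ {r} c<r rc = let p , _ , p-rainbow = rc origin (advance diameter origin) in begin
    diameter       ≡⟨ ‖t‖≡t diameter+diameter≤n ⟨
    ‖ diameter ‖   ≤⟨ ‖t‖≤walkLength diameter (t+t≤n⇒t<n diameter+diameter≤n) refl p ⟩
    walkLength C p ≤⟨ rainbow-length≤ p c<r p-rainbow ⟩
    r              ∎
    where open ≤-Reasoning

  odd⇒¬RainbowConnected : n ≡ suc (diameter + diameter) → 2 ≤ diameter →
                           ∀ {c} → (∀ e → c e < diameter) → ¬ RainbowConnected C c
  odd⇒¬RainbowConnected odd 2≤d {c} c<d rc =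
    Unique-applyUpTo⁻ _ (arc-rainbow origin) z<s 2≤d neighbours
    where
    d = diameter

    1+[d∸1]≡d : suc (d ∸ 1) ≡ d
    1+[d∸1]≡d = m+[n∸m]≡n (≤-trans (n≤1+n 1) 2≤d)

    arc-rainbow : ∀ u → Unique (applyUpTo (λ j → c (advance j u)) d)
    arc-rainbow u = subst Unique (trans (cong (List.map c) forced) (colours-arc c u d)) p-rainbow
      where
      p = proj₁ (rc u (advance d u))
      p-rainbow = proj₂ (proj₂ (rc u (advance d u)))
      2d<n : d + d < n
      2d<n = subst (d + d <_) (sym odd) (n<1+n (d + d))
      forced : walkEdges C p ≡ walkEdges C (arc u d)
      forced = arc-unique d p refl (≤-antisym (rainbow-length≤ p c<d p-rainbow) (begin
        d              ≡⟨ ‖t‖≡t (<⇒≤ 2d<n) ⟨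
        ‖ d ‖          ≤⟨ ‖t‖≤walkLength d (t+t≤n⇒t<n (<⇒≤ 2d<n)) refl p ⟩
        walkLength C p ∎)) 2d<n
        where open ≤-Reasoning

    periodic : ∀ u → c (advance d u) ≡ c u
    periodic u with ∈-applyUpTo⁻ (λ j → c (advance j u)) (full-unique⇒∈ (arc-rainbow u) below
                      (length-applyUpTo _ d) (c<d (advance d u)))
      where
      below : ∀ {x} → x ∈ₗ applyUpTo (λ j → c (advance j u)) d → x < d
      below x∈ = let j , _ , x≡ = ∈-applyUpTo⁻ _ x∈ in subst (_< d) (sym x≡) (c<d _)
    ... | zero  , _     , same = same
    ... | suc j , 1+j<d , same = contradiction
      (trans (sym same) (cong (λ t → c (advance t u)) (sym 1+[d∸1]≡d)))
      (Unique-applyUpTo⁻ _ (arc-rainbow (next u)) (∸-monoˡ-< 1+j<d (s≤s z≤n)) (≤-reflexive 1+[d∸1]≡d))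

    neighbours : c origin ≡ c (next origin)
    neighbours = begin
      c origin                                   ≡⟨ cong c (advance-n origin) ⟨
      c (advance n origin)                       ≡⟨ cong (λ t → c (advance t origin)) odd ⟩
      c (advance (d + d) (next origin))          ≡⟨ cong c (advance-+ d d (next origin)) ⟩
      c (advance d (advance d (next origin)))    ≡⟨ periodic (advance d (next origin)) ⟩
      c (advance d (next origin))                ≡⟨ periodic (next origin) ⟩
      c (next origin)                            ∎
      where open ≡-Reasoning

  rainbowConnected⇒⌈n/2⌉≤ : 4 ≤ n → ∀ {r c} → (∀ e → c e < r) → RainbowConnected C c → ⌈ n /2⌉ ≤ r
  rainbowConnected⇒⌈n/2⌉≤ 4≤n {r} c<r rc
    with ⌈n/2⌉≡⌊n/2⌋∨⌈n/2⌉≡1+⌊n/2⌋ n | m≤n⇒m<n∨m≡n (diameter≤ c<r rc)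
  ... | inj₁ ⌈n/2⌉≡d   | _         = subst (_≤ r) (sym ⌈n/2⌉≡d) (diameter≤ c<r rc)
  ... | inj₂ ⌈n/2⌉≡1+d | inj₁ d<r  = subst (_≤ r) (sym ⌈n/2⌉≡1+d) d<r
  ... | inj₂ ⌈n/2⌉≡1+d | inj₂ refl = contradiction rc (odd⇒¬RainbowConnected odd (⌊n/2⌋-mono 4≤n) c<r)
    where
    odd : n ≡ suc (diameter + diameter)
    odd = trans (sym (⌊n/2⌋+⌈n/2⌉≡n n)) (trans (cong (diameter +_) ⌈n/2⌉≡1+d) (+-suc diameter diameter))

  lowerBound : 4 ≤ n → ∀ r → ListChoosable C (RainbowConnected C) r → ⌈ n /2⌉ ≤ r
  lowerBound 4≤n r choosable =
    let c , c∈upTo , rc = choosable (upToLists r) in rainbowConnected⇒⌈n/2⌉≤ 4≤n (∈-upTo⁻ ∘ c∈upTo) rc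

theorem3p5 : ∀ (n : ℕ) → 4 ≤ n →
    ListRainbowConnectionNumber (Cycle n) ⌈ n /2⌉
    × ListStrongRainbowConnectionNumber (Cycle n) ⌈ n /2⌉
theorem3p5 n 4≤n =
  (ListChoosable-mono StronglyRainbowConnected⇒RainbowConnected upperBound , lowerBound 4≤n) ,
  (upperBound , λ r → lowerBound 4≤n r ∘ ListChoosable-mono StronglyRainbowConnected⇒RainbowConnected)
  where open OnCycle n ⦃ >-nonZero (≤-trans (s≤s z≤n) 4≤n) ⦄
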